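{- Let $(E,f)$ be a polymatroid, let $U\subseteq E$ and $X,Y\subseteq E\setminus U$. Let $(E\cup Z,g)$ be an Ahlswede–Körner extension of $(E,f)$ for the pair $(X\cup U,\,Y\cup U)$. Then the polymatroid $((E\cup Z)\setminus U,\,(g|U))$ is an Ahlswede–Körner extension of the polymatroid $(E\setminus U,\,(f|U))$ for the pair $(X,Y)$.
   Context: A polymatroid is a pair $(E,f)$ with $E$ finite and $f:\mathcal P(E)\to\mathbb R$ monotone, submodular, $f(\emptyset)=0$. Notation: $f(X\mid Z)=f(X\cup Z)-f(Z)$. For $U\subseteq E$, the contraction $(E\setminus U,(f|U))$ is the polymatroid with $(f|U)(X)=f(X\mid U)$. A polymatroid $(E\cup Z,g)$ with $E\cap Z=\emptyset$ is an extension of $(E,f)$ if $g(X)=f(X)$ for all $X\subseteq E$. For $X,Y\subseteq E$, an extension $(E\cup Z,g)$ is an Ahlswede–Körner (AK) extension for the pair $(X,Y)$ if $g(Z\mid X)=0$ and $g(X'\mid Z)=g(X'\mid Y)$ for every $X'\subseteq X$. -}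

module Defs where

open import Level using (Level; _⊔_) renaming (suc to lsuc)
open import Data.Nat using (ℕ)
open import Data.Product using (_×_)
open import Data.Fin.Subset using (Subset; ⊥; _⊆_; _∪_; _∩_; _─_)
open import Relation.Binary.Core using (Rel)
open import Relation.Binary.Structures using (IsTotalOrder)
open import Relation.Binary.PropositionalEquality using (_≡_)
open import Algebra.Bundles using (AbelianGroup)

-- Values of set functions.  The paper uses ℝ, which is not available in
-- agda-stdlib; we work over an arbitrary totally ordered abelian group
-- (ℝ with + and ≤ is an instance).
record OrderedAbelianGroup (c ℓ₁ ℓ₂ : Level) : Set (lsuc (c ⊔ ℓ₁ ⊔ ℓ₂)) where
  field
    abelianGroup : AbelianGroup c ℓ₁
  open AbelianGroup abelianGroup public
  field
    _≤_          : Rel Carrier ℓ₂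
    isTotalOrder : IsTotalOrder _≈_ _≤_
    ≤-translate  : ∀ {x y} z → x ≤ y → (x ∙ z) ≤ (y ∙ z)

-- Everything lives inside a fixed finite universe Fin N; a ground set is a
-- subset E of it, and a set function on E is a function on Subset N of which
-- only the values on subsets of E matter.
module PolymatroidDefs {c ℓ₁ ℓ₂ : Level} (G : OrderedAbelianGroup c ℓ₁ ℓ₂) (N : ℕ) where
  open OrderedAbelianGroup G

  SetFn : Set c
  SetFn = Subset N → Carrier

  _−_ : Carrier → Carrier → Carrier
  x − y = x ∙ (y ⁻¹)

  cond : SetFn → Subset N → Subset N → Carrier
  cond f X Z = f (X ∪ Z) − f Z

  record IsPolymatroid (E : Subset N) (f : SetFn) : Set (c ⊔ ℓ₁ ⊔ ℓ₂) where
    field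
      normalized : f ⊥ ≈ ε
      monotone   : ∀ X Y → X ⊆ E → Y ⊆ E → X ⊆ Y → f X ≤ f Y
      submodular : ∀ X Y → X ⊆ E → Y ⊆ E →
                   (f (X ∪ Y) ∙ f (X ∩ Y)) ≤ (f X ∙ f Y)

  -- contraction by U : (f|U)(X) = f(X | U)   (ground set E ─ U)
  contract : SetFn → Subset N → SetFn
  contract f U X = cond f X U

  record IsExtension (E : Subset N) (f : SetFn) (Z : Subset N) (g : SetFn)
         : Set (c ⊔ ℓ₁ ⊔ ℓ₂) where
    field
      disjoint    : E ∩ Z ≡ ⊥
      polymatroid : IsPolymatroid (E ∪ Z) g
      agrees      : ∀ X → X ⊆ E → g X ≈ f X

  record IsAKExtension (E : Subset N) (f : SetFn) (Z : Subset N) (g : SetFn)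
         (X Y : Subset N) : Set (c ⊔ ℓ₁ ⊔ ℓ₂) where
    field
      extension : IsExtension E f Z g
      Z-given-X : cond g Z X ≈ ε
      X'-given  : ∀ X' → X' ⊆ X → cond g X' Z ≈ cond g X' Y

{-# OPTIONS --safe #-}

-- Contracting by U turns conditional values into conditional values:
-- (g|U)(A | B) = g(A | B ∪ U).  Hence (g|U)(Z | X) = g(Z | X ∪ U) = 0, and
-- since U ⊆ X ∪ U the AK hypothesis gives g(U | Z) = g(U | Y ∪ U) = 0, so
-- adding U to Z in the conditioning set is harmless:
-- (g|U)(X' | Z) = g(X' ∪ U | Z) = g(X' ∪ U | Y ∪ U) = (g|U)(X' | Y).
-- That the contraction of an extension is an extension of the contraction
-- is a routine translation of monotonicity and submodularity by g(U).
module Submission where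

open import Defs
open import Level using (Level)
open import Data.Nat using (ℕ)
open import Data.Fin.Subset using (Subset; _∈_; _⊆_; _∪_; _─_; _∩_; ⊥)
open import Data.Fin.Subset.Properties
open import Data.Sum using (inj₁; inj₂)
open import Data.Product using (_,_)
open import Relation.Binary.PropositionalEquality as ≡ using (_≡_; cong)
import Algebra.Properties.AbelianGroup as AbelianGroupProperties
import Algebra.Properties.CommutativeSemigroup as CommutativeSemigroupProperties
open import Relation.Binary.Structures using (IsTotalOrder)

module _ {N : ℕ} where

  ∪-least : ∀ {A B C : Subset N} → A ⊆ C → B ⊆ C → A ∪ B ⊆ C
  ∪-least {A} {B} A⊆C B⊆C x∈A∪B with x∈p∪q⁻ A B x∈A∪B
  ... | inj₁ x∈A = A⊆C x∈A
  ... | inj₂ x∈B = B⊆C x∈B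

  ∪-monoˡ-⊆ : ∀ {A B : Subset N} C → A ⊆ B → A ∪ C ⊆ B ∪ C
  ∪-monoˡ-⊆ {B = B} C A⊆B = ∪-least (⊆-trans A⊆B (p⊆p∪q C)) (q⊆p∪q B C)

  p⊆q⇒p∪q≡q : ∀ {A B : Subset N} → A ⊆ B → A ∪ B ≡ B
  p⊆q⇒p∪q≡q {A} {B} A⊆B = ⊆-antisym (∪-least A⊆B ⊆-refl) (q⊆p∪q A B)

  ∩-disjointˡ-⊆ : ∀ {A B : Subset N} C → A ⊆ B → B ∩ C ≡ ⊥ → A ∩ C ≡ ⊥
  ∩-disjointˡ-⊆ {A} {B} C A⊆B B∩C≡⊥ = ⊆-antisym A∩C⊆⊥ ⊥⊆
    where
    A∩C⊆⊥ : A ∩ C ⊆ ⊥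
    A∩C⊆⊥ x∈A∩C with x∈p∩q⁻ A C x∈A∩C
    ... | x∈A , x∈C = ≡.subst (_ ∈_) B∩C≡⊥ (x∈p∩q⁺ (A⊆B x∈A , x∈C))

module _ {c ℓ₁ ℓ₂ : Level} (G : OrderedAbelianGroup c ℓ₁ ℓ₂) (N : ℕ) where
  open OrderedAbelianGroup G
  open AbelianGroupProperties abelianGroup using (⁻¹-∙-comm; x∙y⁻¹≈ε⇒x≈y)
  open CommutativeSemigroupProperties commutativeSemigroup using (interchange)
  open IsTotalOrder isTotalOrder using (≤-respˡ-≈; ≤-respʳ-≈)
  open PolymatroidDefs G N
  open import Algebra.Solver.IdempotentCommutativeMonoid (∪-idempotentCommutativeMonoid N)
    using (solve; _⊕_; _⊜_)
  open import Relation.Binary.Reasoning.Setoid setoid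

  −-cancelʳ : ∀ a b u → (a − u) − (b − u) ≈ a − b
  −-cancelʳ a b u = begin
    (a ∙ u ⁻¹) ∙ (b ∙ u ⁻¹) ⁻¹      ≈⟨ ∙-congˡ (sym (⁻¹-∙-comm b (u ⁻¹))) ⟩
    (a ∙ u ⁻¹) ∙ (b ⁻¹ ∙ u ⁻¹ ⁻¹)   ≈⟨ interchange a (u ⁻¹) (b ⁻¹) (u ⁻¹ ⁻¹) ⟩
    (a ∙ b ⁻¹) ∙ (u ⁻¹ ∙ u ⁻¹ ⁻¹)   ≈⟨ ∙-congˡ (inverseʳ (u ⁻¹)) ⟩
    (a ∙ b ⁻¹) ∙ ε                  ≈⟨ identityʳ _ ⟩
    a ∙ b ⁻¹                        ∎

  ∙-−-translate-≤ : ∀ {a b a′ b′} u → (a ∙ b) ≤ (a′ ∙ b′) →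
                    ((a − u) ∙ (b − u)) ≤ ((a′ − u) ∙ (b′ − u))
  ∙-−-translate-≤ {a} {b} {a′} {b′} u ab≤a′b′ =
    ≤-respˡ-≈ (sym (interchange a (u ⁻¹) b (u ⁻¹)))
      (≤-respʳ-≈ (sym (interchange a′ (u ⁻¹) b′ (u ⁻¹)))
        (≤-translate (u ⁻¹ ∙ u ⁻¹) ab≤a′b′))

  cond-contract : ∀ g U A B → cond (contract g U) A B ≈ cond g A (B ∪ U)
  cond-contract g U A B = begin
    (g ((A ∪ B) ∪ U) − g U) − (g (B ∪ U) − g U)  ≈⟨ −-cancelʳ _ _ _ ⟩
    g ((A ∪ B) ∪ U) − g (B ∪ U)                  ≈⟨ ∙-congʳ (reflexive (cong g (∪-assoc A B U))) ⟩
    g (A ∪ (B ∪ U)) − g (B ∪ U)                  ∎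

  cond-⊆ : ∀ g {A B} → A ⊆ B → cond g A B ≈ ε
  cond-⊆ g A⊆B = trans (∙-congʳ (reflexive (cong g (p⊆q⇒p∪q≡q A⊆B)))) (inverseʳ _)

  cond-∪-⊆ : ∀ g A {B C} → C ⊆ B → cond g (A ∪ C) B ≈ cond g A B
  cond-∪-⊆ g A {B} {C} C⊆B =
    ∙-congʳ (reflexive (cong g (≡.trans (∪-assoc A C B) (cong (A ∪_) (p⊆q⇒p∪q≡q C⊆B)))))

  cond-move-null : ∀ g A V Z → cond g V Z ≈ ε → cond g A (Z ∪ V) ≈ cond g (A ∪ V) Z
  cond-move-null g A V Z gV∣Z≈ε = ∙-cong (reflexive (cong g (reorder A V Z))) (⁻¹-cong gZ∪V≈gZ)
    where
    reorder : ∀ A V Z → A ∪ (Z ∪ V) ≡ (A ∪ V) ∪ Z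
    reorder = solve 3 (λ a v z → a ⊕ (z ⊕ v) ⊜ (a ⊕ v) ⊕ z) ≡.refl
    gZ∪V≈gZ : g (Z ∪ V) ≈ g Z
    gZ∪V≈gZ = trans (reflexive (cong g (∪-comm Z V))) (x∙y⁻¹≈ε⇒x≈y _ _ gV∣Z≈ε)

  contract-isPolymatroid : ∀ {E F U g} → IsPolymatroid E g → F ∪ U ⊆ E →
                           IsPolymatroid F (contract g U)
  contract-isPolymatroid {E} {F} {U} {g} g-poly F∪U⊆E = record
    { normalized = cond-⊆ g ⊥⊆
    ; monotone   = λ A B A⊆F B⊆F A⊆B → ≤-translate (g U ⁻¹)
        (monotone (A ∪ U) (B ∪ U) (lift A⊆F) (lift B⊆F) (∪-monoˡ-⊆ U A⊆B))
    ; submodular = λ A B A⊆F B⊆F → ∙-−-translate-≤ (g U)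
        (≤-respˡ-≈ (∙-cong (reflexive (cong g (∪-distribʳ-∪ A B)))
                           (reflexive (cong g (≡.sym (∪-distribʳ-∩ U A B)))))
          (submodular (A ∪ U) (B ∪ U) (lift A⊆F) (lift B⊆F)))
    }
    where
    open IsPolymatroid g-poly
    lift : ∀ {A} → A ⊆ F → A ∪ U ⊆ E
    lift A⊆F = ⊆-trans (∪-monoˡ-⊆ U A⊆F) F∪U⊆E
    ∪-distribʳ-∪ : ∀ A B → (A ∪ U) ∪ (B ∪ U) ≡ (A ∪ B) ∪ U
    ∪-distribʳ-∪ A B = solve 3 (λ a b u → (a ⊕ u) ⊕ (b ⊕ u) ⊜ (a ⊕ b) ⊕ u) ≡.refl A B U

  contract-isExtension : ∀ {E f Z g U} → U ⊆ E → IsExtension E f Z g →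
                         IsExtension (E ─ U) (contract f U) Z (contract g U)
  contract-isExtension {E} {f} {Z} {g} {U} U⊆E ext = record
    { disjoint    = ∩-disjointˡ-⊆ Z (p─q⊆p E U) disjoint
    ; polymatroid = contract-isPolymatroid polymatroid
        (∪-least (∪-least (⊆-trans (p─q⊆p E U) (p⊆p∪q Z)) (q⊆p∪q E Z))
                 (⊆-trans U⊆E (p⊆p∪q Z)))
    ; agrees      = λ A A⊆E─U →
        ∙-cong (agrees (A ∪ U) (∪-least (⊆-trans A⊆E─U (p─q⊆p E U)) U⊆E))
               (⁻¹-cong (agrees U U⊆E))
    }
    where open IsExtension ext

  contract-isAKExtension : ∀ {E f Z g U X Y} → U ⊆ E →
                           IsAKExtension E f Z g (X ∪ U) (Y ∪ U) →
                           IsAKExtension (E ─ U) (contract f U) Z (contract g U) X Y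
  contract-isAKExtension {E} {f} {Z} {g} {U} {X} {Y} U⊆E ak = record
    { extension = contract-isExtension U⊆E extension
    ; Z-given-X = trans (cond-contract g U Z X) Z-given-X
    ; X'-given  = λ X' X'⊆X → begin
        cond (contract g U) X' Z  ≈⟨ cond-contract g U X' Z ⟩
        cond g X' (Z ∪ U)         ≈⟨ cond-move-null g X' U Z gU∣Z≈ε ⟩
        cond g (X' ∪ U) Z         ≈⟨ X'-given (X' ∪ U) (∪-monoˡ-⊆ U X'⊆X) ⟩
        cond g (X' ∪ U) (Y ∪ U)   ≈⟨ cond-∪-⊆ g X' (q⊆p∪q Y U) ⟩
        cond g X' (Y ∪ U)         ≈⟨ sym (cond-contract g U X' Y) ⟩
        cond (contract g U) X' Y  ∎
    }
    where
    open IsAKExtension ak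
    gU∣Z≈ε : cond g U Z ≈ ε
    gU∣Z≈ε = trans (X'-given U (q⊆p∪q X U)) (cond-⊆ g (q⊆p∪q Y U))

mainTheorem4 : ∀ {c ℓ₁ ℓ₂ : Level} (G : OrderedAbelianGroup c ℓ₁ ℓ₂) (N : ℕ) →
    let open PolymatroidDefs G N in
    ∀ (E : Subset N) (f : SetFn) (U X Y Z : Subset N) (g : SetFn) →
    IsPolymatroid E f →
    U ⊆ E → X ⊆ (E ─ U) → Y ⊆ (E ─ U) →
    IsAKExtension E f Z g (X ∪ U) (Y ∪ U) →
    IsAKExtension (E ─ U) (contract f U) Z (contract g U) X Y
mainTheorem4 G N E f U X Y Z g _ U⊆E _ _ = contract-isAKExtension G N U⊆E
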